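{- Let $\mathbf{v}=(v_1,\dots,v_m)$ and $\mathbf{k}=(k_1,\dots,k_m)$ be $m$-tuples of positive integers with $k_i\le v_i$ for all $i$, let $v_{\max}=\max_i v_i$ and $k_{\min}=\min_i k_i$, and suppose there is an index $i$ with $v_i=v_{\max}$ and $k_i=k_{\min}\ge 2$. Then \[ C(\mathbf{v},\mathbf{k},2)= C(v_{\max},k_{\min},2), \] where the right-hand side is the covering number of ordinary $(v_{\max},k_{\min},2)$-covering designs.
   Context: Generalized covering designs: for $m$-tuples of positive integers $\mathbf{v}=(v_1,\dots,v_m)$, $\mathbf{k}=(k_1,\dots,k_m)$ with $k_i\le v_i$ and an integer $t$ with $1\le t\le \sum_i k_i$, let $X_1,\dots,X_m$ be pairwise disjoint sets with $|X_i|=v_i$. A block is an $m$-tuple $(B_1,\dots,B_m)$ with $B_i\subseteq X_i$, $|B_i|=k_i$. An $m$-tuple of sets $(T_1,\dots,T_m)$ is $(\mathbf{v},\mathbf{k},t)$-admissible if $T_i\subseteq X_i$, $|T_i|\le k_i$ and $\sum_i|T_i|=t$; it is contained in a block if $T_i\subseteq B_i$ for all $i$. A ${\rm GC}(\mathbf{v},\mathbf{k},t)$ is a family of blocks (repetitions allowed) such that every admissible tuple is contained in at least one block, and $C(\mathbf{v},\mathbf{k},t)$ is the minimum number of blocks of a ${\rm GC}(\mathbf{v},\mathbf{k},t)$. An ordinary $(v,k,t)$-covering design is a family of $k$-subsets of a $v$-set such that every $t$-subset lies in at least one member; $C(v,k,t)$ is its minimum size. -}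

module Defs where

open import Data.Nat using (ℕ; _≤_)
open import Data.Fin using (Fin)
open import Data.Fin.Subset using (Subset; _⊆_; ∣_∣)
open import Data.Vec using (tabulate; sum)
open import Data.List using (List; length)
open import Data.List.Relation.Unary.Any using (Any)
open import Data.List.Relation.Unary.All using (All)
open import Data.Product using (Σ; _×_; ∃-syntax)
open import Relation.Binary.PropositionalEquality using (_≡_)

-- Ground sets: X_i is modelled as Fin (v i); the X_i are disjoint by construction.

SetTuple : (m : ℕ) → (v : Fin m → ℕ) → Set
SetTuple m v = (i : Fin m) → Subset (v i)

IsBlock : (m : ℕ) (v k : Fin m → ℕ) → SetTuple m v → Set
IsBlock m v k B = (i : Fin m) → ∣ B i ∣ ≡ k i

Admissible : (m : ℕ) (v k : Fin m → ℕ) (t : ℕ) → SetTuple m v → Set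
Admissible m v k t T = ((i : Fin m) → ∣ T i ∣ ≤ k i) × (sum (tabulate (λ i → ∣ T i ∣)) ≡ t)

ContainedIn : (m : ℕ) (v : Fin m → ℕ) → SetTuple m v → SetTuple m v → Set
ContainedIn m v T B = (i : Fin m) → T i ⊆ B i

-- A GC(v,k,t): a list (repetitions allowed) of blocks covering every admissible tuple.
IsGC : (m : ℕ) (v k : Fin m → ℕ) (t : ℕ) → List (SetTuple m v) → Set
IsGC m v k t 𝓑 =
  All (IsBlock m v k) 𝓑 ×
  ((T : SetTuple m v) → Admissible m v k t T → Any (ContainedIn m v T) 𝓑)

IsGCNumber : (m : ℕ) (v k : Fin m → ℕ) (t : ℕ) → ℕ → Set
IsGCNumber m v k t n =
  (Σ (List (SetTuple m v)) λ 𝓑 → IsGC m v k t 𝓑 × length 𝓑 ≡ n) ×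
  ((𝓑 : List (SetTuple m v)) → IsGC m v k t 𝓑 → n ≤ length 𝓑)

IsCovering : (v k t : ℕ) → List (Subset v) → Set
IsCovering v k t 𝓑 =
  All (λ B → ∣ B ∣ ≡ k) 𝓑 ×
  ((T : Subset v) → ∣ T ∣ ≡ t → Any (λ B → T ⊆ B) 𝓑)

IsCoveringNumber : (v k t : ℕ) → ℕ → Set
IsCoveringNumber v k t n =
  (Σ (List (Subset v)) λ 𝓑 → IsCovering v k t 𝓑 × length 𝓑 ≡ n) ×
  ((𝓑 : List (Subset v)) → IsCovering v k t 𝓑 → n ≤ length 𝓑)

-- An admissible 2-tuple occupies at most two points of the disjoint union,
-- and every X_j embeds into the largest coordinate X_i as a prefix. So a
-- (v_max, k_min, 2)-covering design D yields a GC: restrict each block of D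
-- to every X_j and pad it to size k_j (possible since k_min ≤ k_j). Conversely
-- the i-th components of a GC form a (v_i, k_i, 2)-covering design, because
-- a 2-subset of X_i alone is admissible. Hence both minima coincide; the
-- minimum exists constructively since coverings of a given length are
-- decidable by exhaustive search.
module Submission where

open import Defs
open import Level using (0ℓ)
open import Function using (_∘_; id)
open import Data.Nat using (ℕ; zero; suc; _+_; _≤_; _<_; z≤n; s≤s; _≤?_; _≟_)
open import Data.Nat.Properties
  using (suc-injective; ≤-trans; ≤-reflexive; ≤-antisym; ≰⇒>; ≮⇒≥; n≤1+n; +-suc; +-mono-≤; +-monoʳ-≤; +-identityʳ)
open import Data.Fin using (Fin; zero; suc; toℕ; fromℕ; fromℕ<; inject; inject≤)
open import Data.Fin.Properties using (¬∀⟶∃¬-smallest; toℕ-fromℕ; toℕ-fromℕ<; toℕ-inject)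
open import Data.Fin.Subset using (Subset; outside; inside; _⊆_; _∈_; ∣_∣; ⊥; ⊤; _∪_)
open import Data.Fin.Subset.Properties
  using (∣⊥∣≡0; ∣⊤∣≡n; ⊆⊤; p⊆p∪q; q⊆p∪q; in⊆in; out⊆; _⊆?_; anySubset?)
open import Data.Vec using ([]; _∷_; tabulate; sum; here; there)
open import Data.List using (List; []; _∷_; length; map; _++_)
open import Data.List.Properties using (length-map)
open import Data.List.Relation.Unary.Any as Any using (Any; any?)
import Data.List.Relation.Unary.Any.Properties as Any
open import Data.List.Relation.Unary.All as All using (All; all?)
import Data.List.Relation.Unary.All.Properties as All
import Data.List.Membership.Propositional as List
open import Data.List.Membership.Propositional.Properties using (∈-map⁺; ∈-++⁺ˡ; ∈-++⁺ʳ)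
open import Data.Product using (∃; ∃-syntax; _×_; _,_; proj₁; proj₂)
open import Relation.Nullary using (Dec; yes; no; ¬_; ¬?; contradiction)
open import Relation.Nullary.Decidable using (decidable-stable; map′; _×-dec_; _→-dec_)
open import Relation.Unary using (Pred; Decidable)
open import Relation.Binary.PropositionalEquality using (_≡_; refl; sym; trans; cong; subst)

∣⊥∣≤ : ∀ n k → ∣ ⊥ {n} ∣ ≤ k
∣⊥∣≤ n k = subst (_≤ k) (sym (∣⊥∣≡0 n)) z≤n

∣p∪q∣≤∣p∣+∣q∣ : ∀ {n} (p q : Subset n) → ∣ p ∪ q ∣ ≤ ∣ p ∣ + ∣ q ∣
∣p∪q∣≤∣p∣+∣q∣ []            []            = z≤n
∣p∪q∣≤∣p∣+∣q∣ (inside ∷ p)  (inside ∷ q)  = s≤s (≤-trans (∣p∪q∣≤∣p∣+∣q∣ p q) (+-monoʳ-≤ ∣ p ∣ (n≤1+n ∣ q ∣)))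
∣p∪q∣≤∣p∣+∣q∣ (inside ∷ p)  (outside ∷ q) = s≤s (∣p∪q∣≤∣p∣+∣q∣ p q)
∣p∪q∣≤∣p∣+∣q∣ (outside ∷ p) (inside ∷ q)  = ≤-trans (s≤s (∣p∪q∣≤∣p∣+∣q∣ p q)) (≤-reflexive (sym (+-suc ∣ p ∣ ∣ q ∣)))
∣p∪q∣≤∣p∣+∣q∣ (outside ∷ p) (outside ∷ q) = ∣p∪q∣≤∣p∣+∣q∣ p q

extend : ∀ {n k} (S : Subset n) → ∣ S ∣ ≤ k → k ≤ n → ∃ λ B → S ⊆ B × ∣ B ∣ ≡ k
extend {zero} {zero} [] _ _ = [] , id , refl
extend {suc n} {suc k} (inside ∷ S) (s≤s ∣S∣≤k) (s≤s k≤n) =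
  let B , S⊆B , ∣B∣≡k = extend S ∣S∣≤k k≤n in inside ∷ B , in⊆in S⊆B , cong suc ∣B∣≡k
extend {suc n} {k} (outside ∷ S) ∣S∣≤k k≤1+n with k ≤? n
... | yes k≤n = let B , S⊆B , ∣B∣≡k = extend S ∣S∣≤k k≤n in outside ∷ B , out⊆ S⊆B , ∣B∣≡k
... | no  k≰n = ⊤ , ⊆⊤ , trans (∣⊤∣≡n (suc n)) (≤-antisym (≰⇒> k≰n) k≤1+n)

padTo : ∀ {n k} → k ≤ n → (S : Subset n) → ∃ λ B → (∣ S ∣ ≤ k → S ⊆ B) × ∣ B ∣ ≡ k
padTo {n} {k} k≤n S with ∣ S ∣ ≤? k
... | yes ∣S∣≤k = let B , S⊆B , ∣B∣≡k = extend S ∣S∣≤k k≤n in B , (λ _ → S⊆B) , ∣B∣≡k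
... | no  ∣S∣≰k = let B , _ , ∣B∣≡k = extend ⊥ (∣⊥∣≤ n k) k≤n in B , (λ ∣S∣≤k → contradiction ∣S∣≤k ∣S∣≰k) , ∣B∣≡k

pad : ∀ {n k} → k ≤ n → Subset n → Subset n
pad k≤n S = proj₁ (padTo k≤n S)

⊆-pad : ∀ {n k} (k≤n : k ≤ n) (S : Subset n) → ∣ S ∣ ≤ k → S ⊆ pad k≤n S
⊆-pad k≤n S = proj₁ (proj₂ (padTo k≤n S))

∣pad∣≡k : ∀ {n k} (k≤n : k ≤ n) (S : Subset n) → ∣ pad k≤n S ∣ ≡ k
∣pad∣≡k k≤n S = proj₂ (proj₂ (padTo k≤n S))

-- X_m is identified with the prefix of X_n along inject≤.
restrict : ∀ {m n} → m ≤ n → Subset n → Subset m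
restrict z≤n     _       = []
restrict (s≤s p) (x ∷ B) = x ∷ restrict p B

widen : ∀ {m n} → m ≤ n → Subset m → Subset n
widen z≤n     []      = ⊥
widen (s≤s p) (x ∷ T) = x ∷ widen p T

∣restrict∣≤ : ∀ {m n} (p : m ≤ n) (B : Subset n) → ∣ restrict p B ∣ ≤ ∣ B ∣
∣restrict∣≤ z≤n     B             = z≤n
∣restrict∣≤ (s≤s p) (inside ∷ B)  = s≤s (∣restrict∣≤ p B)
∣restrict∣≤ (s≤s p) (outside ∷ B) = ∣restrict∣≤ p B

∣widen∣≡ : ∀ {m n} (p : m ≤ n) (T : Subset m) → ∣ widen p T ∣ ≡ ∣ T ∣
∣widen∣≡ {n = n} z≤n [] = ∣⊥∣≡0 n
∣widen∣≡ (s≤s p) (inside ∷ T)  = cong suc (∣widen∣≡ p T)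
∣widen∣≡ (s≤s p) (outside ∷ T) = ∣widen∣≡ p T

∈-widen : ∀ {m n} (p : m ≤ n) (T : Subset m) {x} → x ∈ T → inject≤ x p ∈ widen p T
∈-widen (s≤s p) (_ ∷ T) here      = here
∈-widen (s≤s p) (_ ∷ T) (there h) = there (∈-widen p T h)

∈-restrict : ∀ {m n} (p : m ≤ n) (B : Subset n) {x} → inject≤ x p ∈ B → x ∈ restrict p B
∈-restrict (s≤s p) (_ ∷ B) {zero}  here      = here
∈-restrict (s≤s p) (_ ∷ B) {suc x} (there h) = there (∈-restrict p B h)

widen⊆⇒⊆restrict : ∀ {m n} (p : m ≤ n) {T B} → widen p T ⊆ B → T ⊆ restrict p B
widen⊆⇒⊆restrict p {T} {B} widenT⊆B = ∈-restrict p B ∘ widenT⊆B ∘ ∈-widen p T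

⋃ᶠ : ∀ {m n} → (Fin m → Subset n) → Subset n
⋃ᶠ {zero}  f = ⊥
⋃ᶠ {suc m} f = f zero ∪ ⋃ᶠ (f ∘ suc)

⊆⋃ᶠ : ∀ {m n} (f : Fin m → Subset n) j → f j ⊆ ⋃ᶠ f
⊆⋃ᶠ {suc m} f zero    = p⊆p∪q (⋃ᶠ (f ∘ suc))
⊆⋃ᶠ {suc m} f (suc j) = q⊆p∪q (f zero) (⋃ᶠ (f ∘ suc)) ∘ ⊆⋃ᶠ (f ∘ suc) j

∣⋃ᶠ∣≤Σ : ∀ {m n} (f : Fin m → Subset n) (g : Fin m → ℕ) → (∀ j → ∣ f j ∣ ≤ g j) →
  ∣ ⋃ᶠ f ∣ ≤ sum (tabulate g)
∣⋃ᶠ∣≤Σ {zero} {n} f g _ = ≤-reflexive (∣⊥∣≡0 n)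
∣⋃ᶠ∣≤Σ {suc m} f g ∣f∣≤g =
  ≤-trans (∣p∪q∣≤∣p∣+∣q∣ (f zero) (⋃ᶠ (f ∘ suc))) (+-mono-≤ (∣f∣≤g zero) (∣⋃ᶠ∣≤Σ (f ∘ suc) (g ∘ suc) (∣f∣≤g ∘ suc)))

single : ∀ {m} (v : Fin m → ℕ) (i : Fin m) → Subset (v i) → SetTuple m v
single v zero    T zero    = T
single v zero    T (suc j) = ⊥
single v (suc i) T zero    = ⊥
single v (suc i) T (suc j) = single (v ∘ suc) i T j

single-≡ : ∀ {m} (v : Fin m → ℕ) i (T : Subset (v i)) → single v i T i ≡ T
single-≡ v zero    T = refl
single-≡ v (suc i) T = single-≡ (v ∘ suc) i T

∣single∣≤ : ∀ {m} (v k : Fin m → ℕ) i (T : Subset (v i)) → ∣ T ∣ ≤ k i → ∀ j → ∣ single v i T j ∣ ≤ k j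
∣single∣≤ v k zero    T ∣T∣≤k zero    = ∣T∣≤k
∣single∣≤ v k zero    T ∣T∣≤k (suc j) = ∣⊥∣≤ (v (suc j)) (k (suc j))
∣single∣≤ v k (suc i) T ∣T∣≤k zero    = ∣⊥∣≤ (v zero) (k zero)
∣single∣≤ v k (suc i) T ∣T∣≤k (suc j) = ∣single∣≤ (v ∘ suc) (k ∘ suc) i T ∣T∣≤k j

Σ∣⊥∣≡0 : ∀ {m} (v : Fin m → ℕ) → sum (tabulate (λ j → ∣ ⊥ {v j} ∣)) ≡ 0
Σ∣⊥∣≡0 {zero}  v = refl
Σ∣⊥∣≡0 {suc m} v rewrite ∣⊥∣≡0 (v zero) = Σ∣⊥∣≡0 (v ∘ suc)

Σ∣single∣≡ : ∀ {m} (v : Fin m → ℕ) i (T : Subset (v i)) → sum (tabulate (λ j → ∣ single v i T j ∣)) ≡ ∣ T ∣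
Σ∣single∣≡ v zero    T rewrite Σ∣⊥∣≡0 (v ∘ suc) = +-identityʳ ∣ T ∣
Σ∣single∣≡ v (suc i) T rewrite ∣⊥∣≡0 (v zero)   = Σ∣single∣≡ (v ∘ suc) i T

single-admissible : ∀ {m t} (v k : Fin m → ℕ) i (T : Subset (v i)) → t ≤ k i → ∣ T ∣ ≡ t →
  Admissible m v k t (single v i T)
single-admissible v k i T t≤k ∣T∣≡t =
  ∣single∣≤ v k i T (≤-trans (≤-reflexive ∣T∣≡t) t≤k) , trans (Σ∣single∣≡ v i T) ∣T∣≡t

allSubsets : ∀ n → List (Subset n)
allSubsets zero    = [] ∷ []
allSubsets (suc n) = map (inside ∷_) (allSubsets n) ++ map (outside ∷_) (allSubsets n)

∈-allSubsets : ∀ {n} (S : Subset n) → S List.∈ allSubsets n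
∈-allSubsets []            = Any.here refl
∈-allSubsets (inside ∷ S)  = ∈-++⁺ˡ (∈-map⁺ (inside ∷_) (∈-allSubsets S))
∈-allSubsets (outside ∷ S) = ∈-++⁺ʳ _ (∈-map⁺ (outside ∷_) (∈-allSubsets S))

allSubset? : ∀ {n} {P : Pred (Subset n) 0ℓ} → Decidable P → Dec (∀ S → P S)
allSubset? P? with anySubset? (¬? ∘ P?)
... | yes (S , ¬PS) = no λ ∀P → ¬PS (∀P S)
... | no  ∄¬P       = yes λ S → decidable-stable (P? S) (λ ¬PS → ∄¬P (S , ¬PS))

anyOfLength? : ∀ {A : Set} → (∀ {P : Pred A 0ℓ} → Decidable P → Dec (∃ P)) →
  ∀ {Q : Pred (List A) 0ℓ} → Decidable Q → ∀ n → Dec (∃ λ xs → Q xs × length xs ≡ n)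
anyOfLength? search Q? zero = map′ (λ q → [] , q , refl) (λ { ([] , q , _) → q }) (Q? [])
anyOfLength? search Q? (suc n) =
  map′ (λ (x , xs , q , eq) → x ∷ xs , q , cong suc eq)
       (λ { (x ∷ xs , q , eq) → x , xs , q , suc-injective eq })
       (search λ x → anyOfLength? search (Q? ∘ (x ∷_)) n)

least-satisfying : ∀ {P : Pred ℕ 0ℓ} → Decidable P → ∀ {n} → P n → ∃ λ m → P m × (∀ {k} → P k → m ≤ k)
least-satisfying {P} P? {n} Pn
  with ¬∀⟶∃¬-smallest (suc n) (¬_ ∘ P ∘ toℕ) (¬? ∘ P? ∘ toℕ)
                      (λ ∀¬P → ∀¬P (fromℕ n) (subst P (sym (toℕ-fromℕ n)) Pn))
... | i , ¬¬Pi , ¬P-below-i =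
  toℕ i , decidable-stable (P? (toℕ i)) ¬¬Pi , λ Pk → ≮⇒≥ λ k<i → ¬P-below-i (fromℕ< k<i) (P-at k<i Pk)
  where
  P-at : ∀ {k} (k<i : k < toℕ i) → P k → P (toℕ (inject (fromℕ< k<i)))
  P-at k<i = subst P (sym (trans (toℕ-inject (fromℕ< k<i)) (toℕ-fromℕ< k<i)))

isCovering? : ∀ v k t 𝓑 → Dec (IsCovering v k t 𝓑)
isCovering? v k t 𝓑 = all? (λ B → ∣ B ∣ ≟ k) 𝓑 ×-dec allSubset? (λ T → ∣ T ∣ ≟ t →-dec any? (T ⊆?_) 𝓑)

trivialCovering : ∀ {v k t} (k≤v : k ≤ v) → t ≤ k → IsCovering v k t (map (pad k≤v) (allSubsets v))
trivialCovering k≤v t≤k =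
  All.map⁺ (All.universal (∣pad∣≡k k≤v) _) ,
  λ T ∣T∣≡t → Any.map⁺ (List.lose (∈-allSubsets T) (⊆-pad k≤v T (≤-trans (≤-reflexive ∣T∣≡t) t≤k)))

coveringNumber-exists : ∀ {v k t} → k ≤ v → t ≤ k → ∃ (IsCoveringNumber v k t)
coveringNumber-exists {v} {k} {t} k≤v t≤k
  with least-satisfying (anyOfLength? anySubset? (isCovering? v k t)) (_ , trivialCovering k≤v t≤k , refl)
... | n , covering , minimal = n , covering , λ 𝓑 cov → minimal (𝓑 , cov , refl)

module _ {m V} (v k : Fin m → ℕ) (k≤v : ∀ j → k j ≤ v j) (v≤V : ∀ j → v j ≤ V) where

  blockOf : Subset V → SetTuple m v
  blockOf B j = pad (k≤v j) (restrict (v≤V j) B)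

  ⊆-blockOf : ∀ {B j} {T : Subset (v j)} → ∣ B ∣ ≤ k j → widen (v≤V j) T ⊆ B → T ⊆ blockOf B j
  ⊆-blockOf {B} {j} ∣B∣≤k widenT⊆B =
    ⊆-pad (k≤v j) _ (≤-trans (∣restrict∣≤ (v≤V j) B) ∣B∣≤k) ∘ widen⊆⇒⊆restrict (v≤V j) widenT⊆B

  trace : SetTuple m v → Subset V
  trace T = ⋃ᶠ (λ j → widen (v≤V j) (T j))

  ∣trace∣≤ : ∀ {t} (T : SetTuple m v) → Admissible m v k t T → ∣ trace T ∣ ≤ t
  ∣trace∣≤ T (_ , ΣT≡t) =
    subst (∣ trace T ∣ ≤_) ΣT≡t (∣⋃ᶠ∣≤Σ _ (∣_∣ ∘ T) (λ j → ≤-reflexive (∣widen∣≡ (v≤V j) (T j))))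

  GC-fromCovering : ∀ {K t D} → (∀ j → K ≤ k j) → t ≤ V → IsCovering V K t D → IsGC m v k t (map blockOf D)
  GC-fromCovering {t = t} {D} K≤k t≤V (D-sizes , D-covers) =
    All.map⁺ (All.universal (λ B j → ∣pad∣≡k (k≤v j) (restrict (v≤V j) B)) D) , covers
    where
    covers : ∀ T → Admissible m v k t T → Any (ContainedIn m v T) (map blockOf D)
    covers T admissible =
      let S , trace⊆S , ∣S∣≡t = extend (trace T) (∣trace∣≤ T admissible) t≤V
          B , B∈D , S⊆B = List.find (D-covers S ∣S∣≡t)
          ∣B∣≤k j = ≤-trans (≤-reflexive (All.lookup D-sizes B∈D)) (K≤k j)
      in List.lose (∈-map⁺ blockOf B∈D) λ j → ⊆-blockOf (∣B∣≤k j) (S⊆B ∘ trace⊆S ∘ ⊆⋃ᶠ _ j)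

covering-fromGC : ∀ {m t} (v k : Fin m → ℕ) i {𝓑} → t ≤ k i → IsGC m v k t 𝓑 →
  IsCovering (v i) (k i) t (map (λ B → B i) 𝓑)
covering-fromGC {m} {t} v k i {𝓑} t≤kᵢ (blocks , covers) =
  All.map⁺ (All.map (λ isBlock → isBlock i) blocks) , covers-i
  where
  ⊆-component : ∀ {T B} → ContainedIn m v (single v i T) B → T ⊆ B i
  ⊆-component {T} {B} T⊆B = subst (_⊆ B i) (single-≡ v i T) (T⊆B i)

  covers-i : ∀ T → ∣ T ∣ ≡ t → Any (T ⊆_) (map (λ B → B i) 𝓑)
  covers-i T ∣T∣≡t =
    Any.map⁺ (Any.map ⊆-component (covers (single v i T) (single-admissible v k i T t≤kᵢ ∣T∣≡t)))

corollary3p19 : (m : ℕ) (v k : Fin m → ℕ) →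
    ((j : Fin m) → 1 ≤ k j) → ((j : Fin m) → k j ≤ v j) →
    (i : Fin m) → ((j : Fin m) → v j ≤ v i) → ((j : Fin m) → k i ≤ k j) → 2 ≤ k i →
    ∃[ n ] (IsGCNumber m v k 2 n × IsCoveringNumber (v i) (k i) 2 n)
corollary3p19 m v k _ k≤v i v≤vᵢ kᵢ≤k 2≤kᵢ with coveringNumber-exists (k≤v i) 2≤kᵢ
... | n , (D , D-covering , refl) , D-minimal =
  length D , (optimalGC , GC-minimal) , (D , D-covering , refl) , D-minimal
  where
  optimalGC : ∃ λ 𝓑 → IsGC m v k 2 𝓑 × length 𝓑 ≡ length D
  optimalGC = map (blockOf v k k≤v v≤vᵢ) D
            , GC-fromCovering v k k≤v v≤vᵢ kᵢ≤k (≤-trans 2≤kᵢ (k≤v i)) D-covering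
            , length-map _ D

  GC-minimal : ∀ 𝓑 → IsGC m v k 2 𝓑 → length D ≤ length 𝓑
  GC-minimal 𝓑 isGC =
    subst (length D ≤_) (length-map (λ B → B i) 𝓑) (D-minimal _ (covering-fromGC v k i 2≤kᵢ isGC))
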